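{- Let $\mathfrak{A}$ be a Heyting algebra. If $t$ is a $\sim$-negation on $\mathfrak{A}$, then $t_{\varepsilon_t}(x)=t(x)$ for all $x$. If $\varepsilon=(a,a^{*})$ is an $\mathcal{E}$-pair in $\mathfrak{A}$, then $\varepsilon_{t_\varepsilon}=\varepsilon$.
   Context: In a Heyting algebra, $(a,a^{*})$ is an $\mathcal{E}$-pair if $a^{*}$ enriches $a$: $a\le a^{*}$, $a^{*}\rightarrow a=a$, and $a^{*}\le x\vee(x\rightarrow a)$ for all $x$. A $\sim$-negation is a unary operation $t$ satisfying for all $x,y$: $x\rightarrow y\le t(y)\rightarrow t(x)$; $x\wedge t(x)\le t(\mathbf{1})$; $t(\mathbf{0})\le x\vee t(x)$; $t(\mathbf{0})\rightarrow t(\mathbf{1})\le t(\mathbf{1})$. For an $\mathcal{E}$-pair $\varepsilon=(a,a^{*})$, $t_\varepsilon(x)=(x\rightarrow a)\wedge a^{*}$; for a $\sim$-negation $t$, $\varepsilon_t=(t(\mathbf{1}),t(\mathbf{0}))$. -}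

module Defs where

open import Level using (_⊔_)
open import Data.Product using (_×_; _,_)
open import Relation.Binary.Lattice using (HeytingAlgebra)

module _ {c ℓ₁ ℓ₂} (H : HeytingAlgebra c ℓ₁ ℓ₂) where
  open HeytingAlgebra H

  IsEPair : Carrier → Carrier → Set (c ⊔ ℓ₁ ⊔ ℓ₂)
  IsEPair a a* =
    (a ≤ a*) × ((a* ⇨ a) ≈ a) × (∀ x → a* ≤ (x ∨ (x ⇨ a)))

  IsSimNegation : (Carrier → Carrier) → Set (c ⊔ ℓ₂)
  IsSimNegation t =
    (∀ x y → (x ⇨ y) ≤ (t y ⇨ t x)) ×
    (∀ x → (x ∧ t x) ≤ t ⊤) ×
    (∀ x → t ⊥ ≤ (x ∨ t x)) ×
    ((t ⊥ ⇨ t ⊤) ≤ t ⊤)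

  tOf : Carrier × Carrier → Carrier → Carrier
  tOf (a , a*) x = (x ⇨ a) ∧ a*

  εOf : (Carrier → Carrier) → Carrier × Carrier
  εOf t = (t ⊤ , t ⊥)

-- Contraposition (the first axiom) makes a ∼-negation t antitone, so t x ≤ t ⊥ and, by
-- x ∧ t x ≤ t ⊤, also t x ≤ x ⇨ t ⊤. Conversely, t ⊥ ≤ x ∨ t x splits (x ⇨ t ⊤) ∧ t ⊥ into
-- a part below (x ⇨ t ⊤) ∧ x ≤ t ⊤ ≤ t x and a part below t x. For an E-pair only a ≤ a* matters: (⊤ ⇨ a) ∧ a* = a ∧ a* = a and
-- (⊥ ⇨ a) ∧ a* = ⊤ ∧ a* = a*.
module Submission where

open import Defs
open import Data.Product using (_×_; _,_; proj₁; proj₂)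
open import Relation.Binary.Lattice using (HeytingAlgebra)
import Relation.Binary.Lattice.Properties.HeytingAlgebra as HeytingAlgebraProperties
import Relation.Binary.Lattice.Properties.MeetSemilattice as MeetSemilatticeProperties
import Relation.Binary.Reasoning.PartialOrder as ≤-Reasoning

module _ {c ℓ₁ ℓ₂} (H : HeytingAlgebra c ℓ₁ ℓ₂) where
  open HeytingAlgebra H
  open HeytingAlgebraProperties H
  open MeetSemilatticeProperties meetSemilattice using (∧-monotonic)

  ⊤≤⇨ : ∀ {x y} → x ≤ y → ⊤ ≤ x ⇨ y
  ⊤≤⇨ x≤y = swap-transpose-⇨ (trans (x∧y≤x _ _) x≤y)

  ⇨-reversing⇒antitone : ∀ {t : Carrier → Carrier} →
                         (∀ x y → (x ⇨ y) ≤ (t y ⇨ t x)) →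
                         ∀ {x y} → x ≤ y → t y ≤ t x
  ⇨-reversing⇒antitone reverses x≤y =
    trans (∧-greatest (trans (maximum _) (trans (⊤≤⇨ x≤y) (reverses _ _))) refl) ⇨-eval

  module _ {t : Carrier → Carrier} (sim : IsSimNegation H t) where
    private
      reverses = proj₁ sim
      x∧tx≤t⊤  = proj₁ (proj₂ sim)
      t⊥≤x∨tx  = proj₁ (proj₂ (proj₂ sim))
      antitone = ⇨-reversing⇒antitone reverses

    tOf-εOf-≤ : ∀ x → tOf H (εOf H t) x ≤ t x
    tOf-εOf-≤ x = begin
      (x ⇨ t ⊤) ∧ t ⊥                   ≤⟨ ∧-monotonic refl (t⊥≤x∨tx x) ⟩
      (x ⇨ t ⊤) ∧ (x ∨ t x)             ≤⟨ ∧-distribˡ-∨-≤ (x ⇨ t ⊤) x (t x) ⟩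
      (x ⇨ t ⊤) ∧ x ∨ (x ⇨ t ⊤) ∧ t x  ≤⟨ ∨-least (trans ⇨-eval (antitone (maximum x))) (x∧y≤y _ _) ⟩
      t x                               ∎
      where open ≤-Reasoning poset

    ≤-tOf-εOf : ∀ x → t x ≤ tOf H (εOf H t) x
    ≤-tOf-εOf x = ∧-greatest (swap-transpose-⇨ (x∧tx≤t⊤ x)) (antitone (minimum x))

    tOf-εOf-≈ : ∀ x → tOf H (εOf H t) x ≈ t x
    tOf-εOf-≈ x = antisym (tOf-εOf-≤ x) (≤-tOf-εOf x)

  tOf-⊤≈ : ∀ {a a*} → a ≤ a* → tOf H (a , a*) ⊤ ≈ a
  tOf-⊤≈ a≤a* = antisym (⇨-applyˡ (maximum _)) (∧-greatest y≤x⇨y a≤a*)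

  tOf-⊥≈ : ∀ a a* → tOf H (a , a*) ⊥ ≈ a*
  tOf-⊥≈ a a* = antisym (x∧y≤y _ _) (∧-greatest (trans (maximum a*) (⊤≤⇨ (minimum a))) refl)

propositionP : ∀ {c ℓ₁ ℓ₂} (H : HeytingAlgebra c ℓ₁ ℓ₂) →
    let open HeytingAlgebra H in
    (∀ (t : Carrier → Carrier) → IsSimNegation H t →
    ∀ x → tOf H (εOf H t) x ≈ t x) ×
    (∀ (a a* : Carrier) → IsEPair H a a* →
    (proj₁ (εOf H (tOf H (a , a*))) ≈ a) × (proj₂ (εOf H (tOf H (a , a*))) ≈ a*))
propositionP H =
  (λ t sim → tOf-εOf-≈ H sim) ,
  (λ a a* ePair → tOf-⊤≈ H (proj₁ ePair) , tOf-⊥≈ H a a*)
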